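{- Let $n>0$ be an integer and let $T$ be a finite sequence of positive integers with $|T|\ge n$ such that $T$ is not $1$-smooth. Then there exists a nonempty subsequence $K$ of $T$ such that $\sigma(K)\equiv 0\pmod n$ and $\sigma(K)\ge 2|K|\ge 2(|T|-(n-1))$.
   Context: A sequence is a finite unordered list with repetition; $\sigma(K)$ is the sum of the terms of $K$ and $|K|$ its length. A nonempty sequence $L$ of positive integers is $1$-smooth iff the set of sums of its nonempty subsequences is exactly $\{1,2,\dots,\sigma(L)\}$. -}

module Defs where

open import Data.Nat using (ℕ; _≤_; _<_)
open import Data.List using (List; []; length)
open import Data.Nat.ListAction using (sum)
open import Data.List.Relation.Unary.All using (All)
open import Data.List.Relation.Binary.Sublist.Propositional using (_⊆_)
open import Data.Product using (∃; _×_)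
open import Relation.Binary.PropositionalEquality using (_≡_; _≢_)
open import Function.Bundles using (_⇔_)

-- A sequence (finite unordered list with repetition) is represented by a
-- List ℕ; a subsequence of T is a sublist K ⊆ T (order is irrelevant for
-- sub-multisets, every sub-multiset arises as a sublist).
-- σ(K) = sum K, |K| = length K.

IsSubseqSum : List ℕ → ℕ → Set
IsSubseqSum L m = ∃ λ K → K ⊆ L × K ≢ [] × sum K ≡ m

OneSmooth : List ℕ → Set
OneSmooth L =
  L ≢ [] × All (λ x → 0 < x) L ×
  (∀ m → IsSubseqSum L m ⇔ (1 ≤ m × m ≤ sum L))

{-# OPTIONS --safe #-}
module Submission where

-- If every term of T is at most 1 + (the number of ones in T), then T is 1-smooth: greedily,
-- any target up to σ(T) is a sum of terms ≥ 2 plus a few ones. So a non-1-smooth T has a term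
-- h ≥ 2 + (number of ones in T); write T = h ∪ T′ and n = m + 1.
--
-- Reading T′ term by term we keep a split T′ = K ∪ R with |R| ≤ m such that either
-- n ∣ h + σ(K), or K has no ones, n ∣ σ(K) and |R| < m. When R becomes too long, a pigeonhole
-- on the n + 1 prefix sums of the arrangement (ones of R) ++ h ∷ (other terms of R) gives a
-- block with sum divisible by n; fewer than n ones cannot form such a block, so the block
-- contains h or avoids the ones, and it is moved into K.
--
-- Finally σ(K) - 2|K| = Σ (x - 2): each one contributes -1, every other term contributes ≥ 0
-- and h contributes at least the number of ones; hence σ ≥ 2|K| both for h ∪ K and for a
-- one-free K.

open import Defs
open import Data.Nat using (ℕ; _≤_; _<_; _*_; _∸_)
open import Data.Nat.Divisibility using (_∣_)
open import Data.List using (List; []; length)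
open import Data.Nat.ListAction using (sum)
open import Data.List.Relation.Unary.All using (All)
open import Data.List.Relation.Binary.Sublist.Propositional using (_⊆_)
open import Data.Product using (∃; _×_)
open import Relation.Binary.PropositionalEquality using (_≢_)
open import Relation.Nullary using (¬_)

open import Data.Fin using (Fin; toℕ; fromℕ<; splitAt; join)
open import Data.Fin.Properties
  using (pigeonhole; toℕ-injective; toℕ≤pred[n]; fromℕ<-injective; join-splitAt)
  renaming (<⇒≢ to <⇒≢ᶠ)
open import Data.List using (_∷_; [_]; take; drop)
open import Data.List.Properties using (take++drop≡id)
open import Data.List.Relation.Binary.Equality.Propositional using (≋-refl)
open import Data.List.Relation.Binary.Permutation.Propositional using (↭-sym)
open import Data.List.Relation.Binary.Permutation.Propositional.Properties using (All-resp-↭)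
open import Data.List.Relation.Binary.Sublist.Propositional using ([]; _∷_; _∷ʳ_; ⊆-trans)
open import Data.List.Relation.Binary.Sublist.Propositional.Properties using (All-resp-⊆)
open import Data.List.Relation.Ternary.Interleaving.Properties using (interleave-length)
open import Data.List.Relation.Ternary.Interleaving.Propositional
  using (Interleaving; []; consˡ; consʳ; right; swap; toPermutation)
open import Data.List.Relation.Ternary.Interleaving.Propositional.Properties
  using (++-linear) renaming (filter⁺ to filter-interleaving)
import Data.List.Relation.Unary.All as All
open import Data.List.Relation.Unary.All using ([]; _∷_)
open import Data.List.Relation.Unary.All.Properties using (all-filter; ¬Any⇒All¬; ++⁺)
open import Data.List.Relation.Unary.Any using (Any; here; there; any?)
open import Data.Nat using (zero; suc; _+_; z≤n; s≤s; NonZero; _≟_; _≤?_; _<?_; _%_; _/_)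
open import Data.Nat.DivMod using (m≡m%n+[m/n]*n; m%n<n; m<n⇒m%n≡m)
open import Data.Nat.Divisibility using (∣m+n∣m⇒∣n; ∣m∣n⇒∣m+n; n∣m*n; _∣0; 1∣_)
open import Data.Nat.ListAction.Properties using (sum-++; sum-↭)
open import Data.Nat.Properties
open import Algebra.Properties.CommutativeSemigroup +-commutativeSemigroup using (x∙yz≈y∙xz)
open import Data.Nat.Solver using (module +-*-Solver)
open import Data.Product using (∃₂; _,_)
open import Data.Sum using (_⊎_; inj₁; inj₂)
open import Function using (_∘_)
open import Function.Bundles using (mk⇔)
open import Relation.Binary.Definitions using (tri<; tri≈; tri>)
open import Relation.Binary.PropositionalEquality
  using (_≡_; refl; sym; trans; cong; subst; subst₂; ≢-sym; module ≡-Reasoning)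
open import Relation.Nullary using (yes; no; contradiction; ¬?)

private variable
  m h : ℕ
  A B C A₁ A₂ B₁ B₂ K R T : List ℕ

0<length⇒≢[] : 0 < length A → A ≢ []
0<length⇒≢[] {_ ∷ _} _ ()

interleave-sum : Interleaving A B C → sum C ≡ sum A + sum B
interleave-sum {A} {B} s = trans (sum-↭ (toPermutation s)) (sum-++ A B)

interleave⇒⊆ : Interleaving A B C → A ⊆ C
interleave⇒⊆ []        = []
interleave⇒⊆ (consˡ s) = refl ∷ interleave⇒⊆ s
interleave⇒⊆ (consʳ s) = _ ∷ʳ interleave⇒⊆ s

All-interleave : ∀ {P : ℕ → Set} → All P A → All P B → Interleaving A B C → All P C
All-interleave pa pb s = All-resp-↭ (↭-sym (toPermutation s)) (++⁺ pa pb)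

take-drop-interleaving : ∀ k (L : List ℕ) → Interleaving (take k L) (drop k L) L
take-drop-interleaving k L = subst (Interleaving _ _) (take++drop≡id k L) (++-linear _ _)

interleave-assoc : Interleaving A B C → Interleaving B₁ B₂ B →
  ∃ λ A′ → Interleaving A′ B₂ C × Interleaving A B₁ A′
interleave-assoc [] [] = [] , [] , []
interleave-assoc (consˡ s) t =
  let A′ , c , a = interleave-assoc s t in _ , consˡ c , consˡ a
interleave-assoc (consʳ s) (consˡ t) =
  let A′ , c , a = interleave-assoc s t in _ , consˡ c , consʳ a
interleave-assoc (consʳ s) (consʳ t) =
  let A′ , c , a = interleave-assoc s t in A′ , consʳ c , a

interleave-refine : Interleaving A B C → Interleaving A₁ A₂ A → Interleaving B₁ B₂ B →
  ∃₂ λ C₁ C₂ → Interleaving C₁ C₂ C × Interleaving A₁ B₁ C₁ × Interleaving A₂ B₂ C₂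
interleave-refine [] [] [] = [] , [] , [] , [] , []
interleave-refine (consˡ s) (consˡ a) b =
  let C₁ , C₂ , c , c₁ , c₂ = interleave-refine s a b in _ , C₂ , consˡ c , consˡ c₁ , c₂
interleave-refine (consˡ s) (consʳ a) b =
  let C₁ , C₂ , c , c₁ , c₂ = interleave-refine s a b in C₁ , _ , consʳ c , c₁ , consˡ c₂
interleave-refine (consʳ s) a (consˡ b) =
  let C₁ , C₂ , c , c₁ , c₂ = interleave-refine s a b in _ , C₂ , consˡ c , consʳ c₁ , c₂
interleave-refine (consʳ s) a (consʳ b) =
  let C₁ , C₂ , c , c₁ , c₂ = interleave-refine s a b in C₁ , _ , consʳ c , c₁ , consʳ c₂

Any-split : ∀ {P : ℕ → Set} → Any P A → ∃₂ λ x A′ → P x × Interleaving [ x ] A′ A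
Any-split {x ∷ A} (here px) = x , A , px , consˡ (right ≋-refl)
Any-split (there p) = let x , A′ , px , s = Any-split p in x , _ ∷ A′ , px , consʳ s

ones : List ℕ → ℕ
ones [] = 0
ones (x ∷ A) with x ≟ 1
... | yes _ = suc (ones A)
... | no _  = ones A

ones≤sum : ∀ A → ones A ≤ sum A
ones≤sum [] = z≤n
ones≤sum (x ∷ A) with x ≟ 1
... | yes refl = s≤s (ones≤sum A)
... | no _     = ≤-trans (ones≤sum A) (m≤n+m (sum A) x)

ones-mono-⊆ : A ⊆ B → ones A ≤ ones B
ones-mono-⊆ [] = z≤n
ones-mono-⊆ (y ∷ʳ s) with y ≟ 1
... | yes _ = m≤n⇒m≤1+n (ones-mono-⊆ s)
... | no _  = ones-mono-⊆ s
ones-mono-⊆ {x ∷ _} (refl ∷ s) with x ≟ 1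
... | yes _ = s≤s (ones-mono-⊆ s)
... | no _  = ones-mono-⊆ s

ones-free : All (_≢ 1) A → ones A ≡ 0
ones-free [] = refl
ones-free {x ∷ _} (x≢1 ∷ a) with x ≟ 1
... | yes x≡1 = contradiction x≡1 x≢1
... | no _    = ones-free a

sum-mono-⊆ : A ⊆ B → sum A ≤ sum B
sum-mono-⊆ []         = z≤n
sum-mono-⊆ (x ∷ʳ s)   = ≤-trans (sum-mono-⊆ s) (m≤n+m _ x)
sum-mono-⊆ (refl ∷ s) = +-monoʳ-≤ _ (sum-mono-⊆ s)

1≤sum : All (0 <_) A → A ≢ [] → 1 ≤ sum A
1≤sum [] A≢[] = contradiction refl A≢[]
1≤sum {x ∷ A} (x>0 ∷ _) _ = ≤-trans x>0 (m≤m+n x (sum A))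

double-length≤sum+ones : All (0 <_) A → 2 * length A ≤ sum A + ones A
double-length≤sum+ones [] = z≤n
double-length≤sum+ones {x ∷ A} (x>0 ∷ pos) with x ≟ 1
... | yes refl = begin
  2 * suc (length A)       ≡⟨ *-suc 2 (length A) ⟩
  2 + 2 * length A         ≤⟨ +-monoʳ-≤ 2 (double-length≤sum+ones pos) ⟩
  2 + (sum A + ones A)     ≡⟨ cong suc (+-suc (sum A) (ones A)) ⟨
  1 + sum A + suc (ones A) ∎
  where open ≤-Reasoning
... | no x≢1 = begin
  2 * suc (length A)       ≡⟨ *-suc 2 (length A) ⟩
  2 + 2 * length A         ≤⟨ +-mono-≤ (≤∧≢⇒< x>0 (≢-sym x≢1)) (double-length≤sum+ones pos) ⟩
  x + (sum A + ones A)     ≡⟨ +-assoc x (sum A) (ones A) ⟨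
  x + sum A + ones A       ∎
  where open ≤-Reasoning

-- c is a supply of ones outside A; a one at the head of A is moved into it.
subsequence-sums : ∀ c A → All (_≤ suc (c + ones A)) A → ∀ s → s ≤ sum A + c →
  ∃₂ λ S k → S ⊆ A × k ≤ c × sum S + k ≡ s
subsequence-sums c [] [] s s≤c = [] , s , [] , s≤c , refl
subsequence-sums c (x ∷ A) (_ ∷ bounds) s s≤ with x ≟ 1
... | yes refl
  with S , k , S⊆A , k≤1+c , ΣS+k≡s ← subsequence-sums (suc c) A
         (subst (λ t → All (_≤ suc t) A) (+-suc c (ones A)) bounds) s
         (subst (s ≤_) (sym (+-suc (sum A) c)) s≤)
  with m≤n⇒m<n∨m≡n k≤1+c
... | inj₁ k<1+c = S , k , 1 ∷ʳ S⊆A , ≤-pred k<1+c , ΣS+k≡s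
... | inj₂ refl  = 1 ∷ S , c , refl ∷ S⊆A , ≤-refl , trans (sym (+-suc (sum S) c)) ΣS+k≡s
subsequence-sums c (x ∷ A) (x≤ ∷ bounds) s s≤ | no _ with s ≤? sum A + c
... | yes s≤′
  with S , k , S⊆A , k≤c , ΣS+k≡s ← subsequence-sums c A bounds s s≤′
  = S , k , x ∷ʳ S⊆A , k≤c , ΣS+k≡s
... | no s≰
  with S , k , S⊆A , k≤c , ΣS+k≡s∸x ← subsequence-sums c A bounds (s ∸ x)
         (m≤n+o⇒m∸n≤o s x (subst (s ≤_) (+-assoc x (sum A) c) s≤))
  = x ∷ S , k , refl ∷ S⊆A , k≤c , (begin-equality
      x + sum S + k   ≡⟨ +-assoc x (sum S) k ⟩
      x + (sum S + k) ≡⟨ cong (x +_) ΣS+k≡s∸x ⟩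
      x + (s ∸ x)     ≡⟨ m+[n∸m]≡n x≤s ⟩
      s               ∎)
  where
  open ≤-Reasoning
  x≤s : x ≤ s
  x≤s = begin
    x                 ≤⟨ x≤ ⟩
    suc (c + ones A)  ≤⟨ s≤s (+-monoʳ-≤ c (ones≤sum A)) ⟩
    suc (c + sum A)   ≡⟨ cong suc (+-comm c (sum A)) ⟩
    suc (sum A + c)   ≤⟨ ≰⇒> s≰ ⟩
    s                 ∎

bounded⇒OneSmooth : A ≢ [] → All (0 <_) A → All (_≤ suc (ones A)) A → OneSmooth A
bounded⇒OneSmooth {A} A≢[] pos bounds = A≢[] , pos , λ s → mk⇔ (range s) (realise s)
  where
  range : ∀ s → IsSubseqSum A s → 1 ≤ s × s ≤ sum A
  range _ (K , K⊆A , K≢[] , refl) = 1≤sum (All-resp-⊆ K⊆A pos) K≢[] , sum-mono-⊆ K⊆A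
  realise : ∀ s → 1 ≤ s × s ≤ sum A → IsSubseqSum A s
  realise s (1≤s , s≤)
    with subsequence-sums 0 A bounds s (subst (s ≤_) (sym (+-identityʳ (sum A))) s≤)
  ... | S , _ , S⊆A , z≤n , refl =
    S , S⊆A , (λ { refl → contradiction 1≤s λ () }) , sym (+-identityʳ (sum S))

large-term : A ≢ [] → All (0 <_) A → ¬ OneSmooth A →
  ∃₂ λ h A′ → 2 + ones A ≤ h × Interleaving [ h ] A′ A
large-term {A} A≢[] pos ¬smooth with any? (λ x → suc (ones A) <? x) A
... | yes large = Any-split large
... | no ¬large =
  contradiction (bounded⇒OneSmooth A≢[] pos (All.map ≮⇒≥ (¬Any⇒All¬ A ¬large))) ¬smooth

m%n≡[m+o]%n⇒n∣o : ∀ n .{{_ : NonZero n}} {m o} → m % n ≡ (m + o) % n → n ∣ o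
m%n≡[m+o]%n⇒n∣o n {m} {o} eq =
  ∣m+n∣m⇒∣n (subst (n ∣_) (sym quotients) (n∣m*n ((m + o) / n))) (n∣m*n (m / n))
  where
  open ≡-Reasoning
  quotients : (m / n) * n + o ≡ ((m + o) / n) * n
  quotients = +-cancelˡ-≡ (m % n) _ _ (begin
    m % n + ((m / n) * n + o)       ≡⟨ +-assoc (m % n) _ o ⟨
    m % n + (m / n) * n + o         ≡⟨ cong (_+ o) (m≡m%n+[m/n]*n m n) ⟨
    m + o                           ≡⟨ m≡m%n+[m/n]*n (m + o) n ⟩
    (m + o) % n + ((m + o) / n) * n ≡⟨ cong (_+ ((m + o) / n) * n) eq ⟨
    m % n + ((m + o) / n) * n       ∎)

pigeonhole-% : ∀ n .{{_ : NonZero n}} {a b} → n < a + b → (f : Fin a ⊎ Fin b → ℕ) →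
  ∃₂ λ i j → i ≢ j × f i % n ≡ f j % n
pigeonhole-% n {a} {b} n<a+b f =
  let k , l , k<l , eq = pigeonhole n<a+b residue
  in splitAt a k , splitAt a l , <⇒≢ᶠ k<l ∘ splitAt-injective , fromℕ<-injective _ _ _ _ eq
  where
  residue : Fin (a + b) → Fin n
  residue k = fromℕ< (m%n<n (f (splitAt a k)) n)
  splitAt-injective : ∀ {k l} → splitAt a k ≡ splitAt a l → k ≡ l
  splitAt-injective {k} {l} e =
    trans (sym (join-splitAt a b k)) (trans (cong (join a b) e) (join-splitAt a b l))

prefix-length≤ : ∀ (L : List ℕ) (k : Fin (suc (length L))) → toℕ k ≤ length L
prefix-length≤ L = toℕ≤pred[n]

block-between-prefixes : ∀ {i j} L → i < j → j ≤ length L →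
  ∃₂ λ B R → Interleaving B R L × 0 < length B × sum (take i L) + sum B ≡ sum (take j L)
block-between-prefixes {zero} {suc j} (x ∷ L) _ _ =
  x ∷ take j L , drop j L , consˡ (take-drop-interleaving j L) , s≤s z≤n , refl
block-between-prefixes {suc i} {suc j} (x ∷ L) (s≤s i<j) (s≤s j≤|L|) =
  let B , R , s , |B|>0 , e = block-between-prefixes L i<j j≤|L|
  in B , x ∷ R , consʳ s , |B|>0 , trans (+-assoc x _ _) (cong (x +_) e)

zero-sum-block : ∀ o L {i j} → i < j → j ≤ length L →
  (o + sum (take i L)) % suc m ≡ (o + sum (take j L)) % suc m →
  ∃₂ λ B R → Interleaving B R L × 0 < length B × suc m ∣ sum B
zero-sum-block {m} o L {i} {j} i<j j≤|L| eq =
  let B , R , s , |B|>0 , e = block-between-prefixes L i<j j≤|L|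
  in B , R , s , |B|>0 , m%n≡[m+o]%n⇒n∣o (suc m) {o + sum (take i L)} (trans eq (cong (_% suc m) (begin
    o + sum (take j L)           ≡⟨ cong (o +_) e ⟨
    o + (sum (take i L) + sum B) ≡⟨ +-assoc o _ _ ⟨
    o + sum (take i L) + sum B   ∎)))
  where open ≡-Reasoning

zero-sum-between-prefixes : ∀ o L {i j} → i ≢ j → i ≤ length L → j ≤ length L →
  (o + sum (take i L)) % suc m ≡ (o + sum (take j L)) % suc m →
  ∃₂ λ B R → Interleaving B R L × 0 < length B × suc m ∣ sum B
zero-sum-between-prefixes o L {i} {j} i≢j i≤|L| j≤|L| eq with <-cmp i j
... | tri< i<j _ _ = zero-sum-block o L i<j j≤|L| eq
... | tri≈ _ i≡j _ = contradiction i≡j i≢j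
... | tri> _ _ j<i = zero-sum-block o L j<i i≤|L| (sym eq)

data Extraction (m h : ℕ) (T : List ℕ) : Set where
  with-head : Interleaving K R T → suc m ∣ h + sum K → length R ≤ m → Extraction m h T
  one-free  : Interleaving K R T → All (_≢ 1) K → suc m ∣ sum K → length R < m →
              Extraction m h T

sum-take-ones : ∀ {k O} → All (_≡ 1) O → k ≤ length O → sum (take k O) ≡ k
sum-take-ones {zero}  _             _        = refl
sum-take-ones {suc k} (refl ∷ ones) (s≤s k≤) = cong suc (sum-take-ones ones k≤)

arrangement-sums : ℕ → (O V : List ℕ) → Fin (suc (length O)) ⊎ Fin (suc (length V)) → ℕ
arrangement-sums h O V (inj₁ c) = sum (take (toℕ c) O)
arrangement-sums h O V (inj₂ k) = sum O + h + sum (take (toℕ k) V)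

module _ {m h : ℕ} {O V W : List ℕ} (W≡O⊎V : Interleaving O V W) (all-ones : All (_≡ 1) O)
         (no-ones : All (_≢ 1) V) (|W|≡m : length W ≡ m) where

  private
    |O|+|V|≡m : length O + length V ≡ m
    |O|+|V|≡m = trans (sym (interleave-length W≡O⊎V)) |W|≡m

    more-sums-than-residues : suc m < suc (length O) + suc (length V)
    more-sums-than-residues = subst (λ t → suc t < suc (length O) + suc (length V)) |O|+|V|≡m
      (s≤s (+-monoʳ-< (length O) (n<1+n (length V))))

    ones-residue : ∀ (c : Fin (suc (length O))) → sum (take (toℕ c) O) % suc m ≡ toℕ c
    ones-residue c = trans (cong (_% suc m) (sum-take-ones all-ones (prefix-length≤ O c)))
      (m<n⇒m%n≡m (s≤s (≤-trans (prefix-length≤ O c)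
        (subst (length O ≤_) |O|+|V|≡m (m≤m+n (length O) (length V))))))

    through-head : ∀ (c : Fin (suc (length O))) (k : Fin (suc (length V))) →
      sum (take (toℕ c) O) % suc m ≡ (sum O + h + sum (take (toℕ k) V)) % suc m →
      Extraction m h W
    through-head c k eq
      with Z , Z′ , W≡Z⊎Z′ , Z≡drop⊎take , _ ← interleave-refine W≡O⊎V
             (swap (take-drop-interleaving (toℕ c) O)) (take-drop-interleaving (toℕ k) V)
      = with-head W≡Z⊎Z′ (m%n≡[m+o]%n⇒n∣o (suc m) {a} (trans eq (cong (_% suc m) rearranged)))
          (subst (length Z′ ≤_) (trans (sym (interleave-length W≡Z⊎Z′)) |W|≡m)
            (m≤n+m (length Z′) (length Z)))
      where
      open ≡-Reasoning
      open +-*-Solver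
      a = sum (take (toℕ c) O)
      b = sum (drop (toℕ c) O)
      p = sum (take (toℕ k) V)
      rearranged : sum O + h + p ≡ a + (h + sum Z)
      rearranged = begin
        sum O + h + p     ≡⟨ cong (λ t → t + h + p) (interleave-sum (take-drop-interleaving (toℕ c) O)) ⟩
        a + b + h + p     ≡⟨ solve 4 (λ a b h p → a :+ b :+ h :+ p := a :+ (h :+ (b :+ p))) refl a b h p ⟩
        a + (h + (b + p)) ≡⟨ cong (λ t → a + (h + t)) (interleave-sum Z≡drop⊎take) ⟨
        a + (h + sum Z)   ∎

    within-others : ∀ (k l : Fin (suc (length V))) → k ≢ l →
      (sum O + h + sum (take (toℕ k) V)) % suc m ≡ (sum O + h + sum (take (toℕ l) V)) % suc m →
      Extraction m h W
    within-others k l k≢l eq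
      with B , R , V≡B⊎R , |B|>0 , n∣ΣB ← zero-sum-between-prefixes (sum O + h) V
             (k≢l ∘ toℕ-injective) (prefix-length≤ V k) (prefix-length≤ V l) eq
      with E , W≡E⊎B , _ ← interleave-assoc W≡O⊎V (swap V≡B⊎R)
      = one-free (swap W≡E⊎B) (All-resp-⊆ (interleave⇒⊆ V≡B⊎R) no-ones) n∣ΣB
          (subst (length E <_) (trans (sym (interleave-length W≡E⊎B)) |W|≡m)
            (m<m+n (length E) |B|>0))

  extraction-of-partition : Extraction m h W
  extraction-of-partition
    with pigeonhole-% (suc m) more-sums-than-residues (arrangement-sums h O V)
  ... | inj₁ c , inj₁ d , c≢d , eq = contradiction
    (cong inj₁ (toℕ-injective (trans (sym (ones-residue c)) (trans eq (ones-residue d))))) c≢d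
  ... | inj₁ c , inj₂ k , _   , eq = through-head c k eq
  ... | inj₂ k , inj₁ c , _   , eq = through-head c k (sym eq)
  ... | inj₂ k , inj₂ l , k≢l , eq = within-others k l (k≢l ∘ cong inj₂) eq

extraction-of-length : ∀ h W → length W ≡ m → Extraction m h W
extraction-of-length h W = extraction-of-partition {h = h}
  (filter-interleaving (_≟ 1) W) (all-filter (_≟ 1) W) (all-filter (¬? ∘ (_≟ 1)) W)

-- The first term plays the role of h.
zero-sum-subsequence : ∀ U → length U ≡ suc m →
  ∃₂ λ Z Z′ → Interleaving Z Z′ U × suc m ∣ sum Z × length Z′ ≤ m
zero-sum-subsequence (x ∷ W) |U|≡1+m with extraction-of-length x W (suc-injective |U|≡1+m)
... | with-head W≡Z⊎Z′ n∣x+ΣZ |Z′|≤m = _ , _ , consˡ W≡Z⊎Z′ , n∣x+ΣZ , |Z′|≤m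
... | one-free  W≡Z⊎Z′ _ n∣ΣZ |Z′|<m  = _ , _ , consʳ W≡Z⊎Z′ , n∣ΣZ , |Z′|<m

absorb-zero-sum : ∀ {Z Z′} → Interleaving K R T → suc m ∣ h + sum K →
  Interleaving Z Z′ R → suc m ∣ sum Z → length Z′ ≤ m → Extraction m h T
absorb-zero-sum {K} {m = m} {h} {Z} T≡K⊎R n∣h+ΣK R≡Z⊎Z′ n∣ΣZ |Z′|≤m
  with E , T≡E⊎Z′ , E≡K⊎Z ← interleave-assoc T≡K⊎R R≡Z⊎Z′
  = with-head T≡E⊎Z′ (subst (suc m ∣_) h+ΣK+ΣZ≡h+ΣE (∣m∣n⇒∣m+n n∣h+ΣK n∣ΣZ)) |Z′|≤m
  where
  h+ΣK+ΣZ≡h+ΣE : h + sum K + sum Z ≡ h + sum E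
  h+ΣK+ΣZ≡h+ΣE = trans (+-assoc h (sum K) (sum Z)) (cong (h +_) (sym (interleave-sum E≡K⊎Z)))

absorb-into-one-free : Interleaving K R T → All (_≢ 1) K → suc m ∣ sum K →
  Extraction m h R → Extraction m h T
absorb-into-one-free {K} {m = m} {h = h} T≡K⊎R _ n∣ΣK (with-head {Z} R≡Z⊎Z′ n∣h+ΣZ |Z′|≤m)
  with E , T≡E⊎Z′ , E≡K⊎Z ← interleave-assoc T≡K⊎R R≡Z⊎Z′
  = with-head T≡E⊎Z′ (subst (suc m ∣_) ΣK+[h+ΣZ]≡h+ΣE (∣m∣n⇒∣m+n n∣ΣK n∣h+ΣZ)) |Z′|≤m
  where
  ΣK+[h+ΣZ]≡h+ΣE : sum K + (h + sum Z) ≡ h + sum E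
  ΣK+[h+ΣZ]≡h+ΣE = trans (x∙yz≈y∙xz (sum K) h (sum Z)) (cong (h +_) (sym (interleave-sum E≡K⊎Z)))
absorb-into-one-free {m = m} T≡K⊎R no-ones n∣ΣK (one-free R≡Z⊎Z′ no-onesᶻ n∣ΣZ |Z′|<m)
  with E , T≡E⊎Z′ , E≡K⊎Z ← interleave-assoc T≡K⊎R R≡Z⊎Z′
  = one-free T≡E⊎Z′ (All-interleave no-ones no-onesᶻ E≡K⊎Z)
      (subst (suc m ∣_) (sym (interleave-sum E≡K⊎Z)) (∣m∣n⇒∣m+n n∣ΣK n∣ΣZ)) |Z′|<m

extraction : ∀ m h T → Extraction m h T
extraction zero    h []      = with-head [] (1∣ _) z≤n
extraction (suc m) h []      = one-free [] [] (_ ∣0) (s≤s z≤n)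
extraction m       h (x ∷ T) = extend (extraction m h T)
  where
  extend : Extraction m h T → Extraction m h (x ∷ T)
  extend (with-head {R = R} T≡K⊎R n∣h+ΣK |R|≤m) with length R <? m
  ... | yes |R|<m = with-head (consʳ T≡K⊎R) n∣h+ΣK |R|<m
  ... | no |R|≮m =
    let Z , Z′ , xR≡Z⊎Z′ , n∣ΣZ , |Z′|≤m =
          zero-sum-subsequence (x ∷ R) (cong suc (≤-antisym |R|≤m (≮⇒≥ |R|≮m)))
    in absorb-zero-sum (consʳ T≡K⊎R) n∣h+ΣK xR≡Z⊎Z′ n∣ΣZ |Z′|≤m
  extend (one-free {R = R} T≡K⊎R no-ones n∣ΣK |R|<m) with suc (length R) <? m
  ... | yes |xR|<m = one-free (consʳ T≡K⊎R) no-ones n∣ΣK |xR|<m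
  ... | no |xR|≮m = absorb-into-one-free (consʳ T≡K⊎R) no-ones n∣ΣK
    (extraction-of-length h (x ∷ R) (≤-antisym |R|<m (≮⇒≥ |xR|≮m)))

LongZeroSumSubsequence : ℕ → List ℕ → Set
LongZeroSumSubsequence m T = ∃ λ K → K ⊆ T × K ≢ [] × suc m ∣ sum K ×
  2 * length K ≤ sum K × 2 * (length T ∸ m) ≤ 2 * length K

long-zero-sum-subsequence : Interleaving K R T → 0 < length K → suc m ∣ sum K →
  2 * length K ≤ sum K → length R ≤ m → LongZeroSumSubsequence m T
long-zero-sum-subsequence {K} {R} {T} {m} T≡K⊎R |K|>0 n∣ΣK 2|K|≤ΣK |R|≤m =
  K , interleave⇒⊆ T≡K⊎R , 0<length⇒≢[] |K|>0 , n∣ΣK , 2|K|≤ΣK ,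
  *-monoʳ-≤ 2 (m≤n+o⇒m∸n≤o (length T) m (begin
    length T            ≡⟨ interleave-length T≡K⊎R ⟩
    length K + length R ≤⟨ +-monoʳ-≤ (length K) |R|≤m ⟩
    length K + m        ≡⟨ +-comm (length K) m ⟩
    m + length K        ∎))
  where open ≤-Reasoning

double-length-with-head : All (0 <_) K → 2 + ones K ≤ h → 2 * suc (length K) ≤ h + sum K
double-length-with-head {K} {h} pos 2+ones≤h = begin
  2 * suc (length K)   ≡⟨ *-suc 2 (length K) ⟩
  2 + 2 * length K     ≤⟨ +-monoʳ-≤ 2 (double-length≤sum+ones pos) ⟩
  2 + (sum K + ones K) ≡⟨ cong (2 +_) (+-comm (sum K) (ones K)) ⟩
  2 + (ones K + sum K) ≡⟨ +-assoc 2 (ones K) (sum K) ⟨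
  2 + ones K + sum K   ≤⟨ +-monoˡ-≤ (sum K) 2+ones≤h ⟩
  h + sum K            ∎
  where open ≤-Reasoning

module _ {h m : ℕ} {T T′ : List ℕ} (positive : All (0 <_) T) (T≡h⊎T′ : Interleaving [ h ] T′ T)
         {K R} (T′≡K⊎R : Interleaving K R T′) where

  private
    K⊆T : K ⊆ T
    K⊆T = ⊆-trans (interleave⇒⊆ T′≡K⊎R) (interleave⇒⊆ (swap T≡h⊎T′))

  with-head⇒long-zero-sum : 2 + ones T ≤ h → suc m ∣ h + sum K → length R ≤ m →
    LongZeroSumSubsequence m T
  with-head⇒long-zero-sum 2+ones≤h n∣h+ΣK |R|≤m
    with E , T≡E⊎R , E≡h⊎K ← interleave-assoc T≡h⊎T′ T′≡K⊎R
    = long-zero-sum-subsequence T≡E⊎R (subst (0 <_) (sym |E|≡1+|K|) (s≤s z≤n))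
        (subst (suc m ∣_) (sym ΣE≡h+ΣK) n∣h+ΣK)
        (subst₂ (λ l s → 2 * l ≤ s) (sym |E|≡1+|K|) (sym ΣE≡h+ΣK)
          (double-length-with-head (All-resp-⊆ K⊆T positive)
            (≤-trans (+-monoʳ-≤ 2 (ones-mono-⊆ K⊆T)) 2+ones≤h)))
        |R|≤m
    where
    |E|≡1+|K| : length E ≡ suc (length K)
    |E|≡1+|K| = interleave-length E≡h⊎K
    ΣE≡h+ΣK : sum E ≡ h + sum K
    ΣE≡h+ΣK = trans (interleave-sum E≡h⊎K) (cong (_+ sum K) (+-identityʳ h))

  one-free⇒long-zero-sum : suc m ≤ length T → All (_≢ 1) K → suc m ∣ sum K → length R < m →
    LongZeroSumSubsequence m T
  one-free⇒long-zero-sum n≤|T| no-ones n∣ΣK |R|<m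
    with E , T≡E⊎K , E≡h⊎R ← interleave-assoc T≡h⊎T′ (swap T′≡K⊎R)
    = long-zero-sum-subsequence (swap T≡E⊎K) |K|>0 n∣ΣK 2|K|≤ΣK |E|≤m
    where
    |E|≤m : length E ≤ m
    |E|≤m = subst (_≤ m) (sym (interleave-length E≡h⊎R)) |R|<m
    |K|>0 : 0 < length K
    |K|>0 = +-cancelʳ-< (length E) 0 (length K)
      (≤-trans (s≤s |E|≤m) (subst (suc m ≤_) (interleave-length (swap T≡E⊎K)) n≤|T|))
    2|K|≤ΣK : 2 * length K ≤ sum K
    2|K|≤ΣK = subst (2 * length K ≤_) (trans (cong (sum K +_) (ones-free no-ones)) (+-identityʳ (sum K)))
      (double-length≤sum+ones (All-resp-⊆ K⊆T positive))

mainTheorem8 : (n : ℕ) → 0 < n → (T : List ℕ) → All (λ x → 0 < x) T →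
    n ≤ length T → ¬ OneSmooth T →
    ∃ λ K → K ⊆ T × K ≢ [] × n ∣ sum K ×
      2 * length K ≤ sum K × 2 * (length T ∸ (n ∸ 1)) ≤ 2 * length K
mainTheorem8 (suc m) _ T positive n≤|T| ¬smooth
  with h , T′ , 2+ones≤h , T≡h⊎T′ ←
         large-term (0<length⇒≢[] (≤-trans (s≤s z≤n) n≤|T|)) positive ¬smooth
  with extraction m h T′
... | with-head T′≡K⊎R n∣h+ΣK |R|≤m =
  with-head⇒long-zero-sum positive T≡h⊎T′ T′≡K⊎R 2+ones≤h n∣h+ΣK |R|≤m
... | one-free T′≡K⊎R no-ones n∣ΣK |R|<m =
  one-free⇒long-zero-sum positive T≡h⊎T′ T′≡K⊎R n≤|T| no-ones n∣ΣK |R|<m
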